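{- Let $t_{n,m}$ denote the number of growing binary trees with $n$ internal nodes and $m$ anchors, and for $n\ge 1$ let $a_n=\max\{k\ge 1 : t_{n,2k}>0\}$. Then $a_1=1$, and for every $n>1$, \[ a_n=\max\{k : 1\le k\le n-1,\ k\le 2a_{n-k}\}. \]
   Context: Growing binary trees are plane (ordered) binary trees whose nodes are of three types: internal nodes, anchors (active leaves) and dead leaves. They are produced by the following growth process: at time $t=0$ the tree consists of a single anchor; at each time $t=1,2,\dots$, every anchor is simultaneously replaced either by a dead leaf or by an internal node with two anchors as children. A growing binary tree is any tree obtainable after finitely many steps of this process. Every growing binary tree other than the initial one has an even number of anchors. $t_{n,m}$ counts distinct such trees (as plane trees with node types) with $n$ internal nodes and $m$ anchors. -}

module Defs where

open import Data.Nat using (ℕ; zero; suc; _+_; _*_; _∸_; _≤_; _<_)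
open import Data.Product using (Σ; ∃; _×_)
open import Relation.Binary.PropositionalEquality using (_≡_)

data Tree : Set where
  anchor : Tree
  dead   : Tree
  node   : Tree → Tree → Tree

data Step : Tree → Tree → Set where
  anchor→dead : Step anchor dead
  anchor→node : Step anchor (node anchor anchor)
  dead→dead   : Step dead dead
  node→node   : ∀ {l r l′ r′} → Step l l′ → Step r r′ → Step (node l r) (node l′ r′)

data Reach : ℕ → Tree → Set where
  start : Reach zero anchor
  grow  : ∀ {t T T′} → Reach t T → Step T T′ → Reach (suc t) T′

Growing : Tree → Set
Growing T = ∃ λ t → Reach t T

internals : Tree → ℕ
internals anchor     = 0
internals dead       = 0
internals (node l r) = suc (internals l + internals r)

anchors : Tree → ℕ
anchors anchor     = 1
anchors dead       = 0
anchors (node l r) = anchors l + anchors r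

-- t_{n,m} > 0 : there is a growing binary tree with n internal nodes and m anchors.
TPos : ℕ → ℕ → Set
TPos n m = Σ Tree λ T → Growing T × internals T ≡ n × anchors T ≡ m

IsMax : (ℕ → Set) → ℕ → Set
IsMax P a = P a × (∀ k → P k → k ≤ a)

ASet : ℕ → ℕ → Set
ASet n k = 1 ≤ k × TPos n (2 * k)

IsASeq : (ℕ → ℕ) → Set
IsASeq a = ∀ n → 1 ≤ n → IsMax (ASet n) (a n)

RecSet : (ℕ → ℕ) → ℕ → ℕ → Set
RecSet a n k = 1 ≤ k × k ≤ n ∸ 1 × k ≤ 2 * a (n ∸ k)

{-# OPTIONS --safe #-}
-- A step that turns c of the current anchors into internal nodes (and the others into dead
-- leaves) adds c internal nodes and leaves 2c anchors, and every c up to the current number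
-- of anchors is realised by some step. Hence the pairs (n, 2k), k ≥ 1, realised by growing
-- trees are generated from (1, 2) by the moves (n, 2j) ↦ (n + k, 2k) with 1 ≤ k ≤ 2j. A pair
-- (n, 2k) with n > 1 must come from a pair (n − k, 2j) by such a move, and the best choice of j
-- is a_{n−k}; so (n, 2k) is realised iff k ≤ n − 1 and k ≤ 2a_{n−k}. The same equivalence makes
-- realisability decidable by strong induction on n, and k ≤ n bounds the search for a_n.
module Submission where

open import Defs
open import Data.Nat using (ℕ; zero; suc; _+_; _*_; _∸_; _≤_; _<_; z≤n; s≤s; _≤?_)
open import Data.Nat.Induction using (<-rec)
open import Data.Nat.Properties
open import Algebra.Properties.CommutativeSemigroup +-commutativeSemigroup using (interchange)
open import Data.Product using (Σ; ∃; ∃-syntax; _×_; _,_; proj₁; proj₂)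
open import Function.Bundles using (_⇔_; mk⇔; Equivalence)
open import Function.Properties.Equivalence using () renaming (sym to ⇔-sym)
open import Induction.WellFounded using (WfRec)
open import Relation.Nullary using (yes; no; contradiction)
import Relation.Nullary.Decidable as Dec
open import Relation.Unary using (Decidable)
open import Relation.Binary.PropositionalEquality using (_≡_; refl; sym; trans; cong; cong₂; subst)

IsMax-resp-⇔ : ∀ {P Q : ℕ → Set} {a} → (∀ k → P k ⇔ Q k) → IsMax P a → IsMax Q a
IsMax-resp-⇔ P⇔Q (pa , maximal) =
  Equivalence.to (P⇔Q _) pa , λ k qk → maximal k (Equivalence.from (P⇔Q k) qk)

bounded-max : ∀ {P : ℕ → Set} → Decidable P → ∀ b → (∀ k → P k → k ≤ b) →
              ∀ {w} → P w → ∃ (IsMax P)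
bounded-max P? b bounded pw with P? b
... | yes pb = b , pb , bounded
bounded-max {P} P? zero bounded pw | no ¬pb =
  contradiction (subst P (n≤0⇒n≡0 (bounded _ pw)) pw) ¬pb
bounded-max P? (suc b) bounded pw | no ¬pb =
  bounded-max P? b (λ k pk → m<1+n⇒m≤n (≤∧≢⇒< (bounded k pk) λ { refl → ¬pb pk })) pw

record Sprouts (c : ℕ) (T T′ : Tree) : Set where
  constructor ⟨_,_⟩
  field
    internals-≡ : internals T′ ≡ internals T + c
    anchors-≡   : anchors T′ ≡ 2 * c

Sprouts-node : ∀ {c₁ c₂ l r l′ r′} → Sprouts c₁ l l′ → Sprouts c₂ r r′ →
               Sprouts (c₁ + c₂) (node l r) (node l′ r′)
Sprouts-node {c₁} {c₂} {l} {r} ⟨ i₁ , a₁ ⟩ ⟨ i₂ , a₂ ⟩ = ⟨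
  cong suc (trans (cong₂ _+_ i₁ i₂) (interchange (internals l) c₁ (internals r) c₂)) ,
  trans (cong₂ _+_ a₁ a₂) (sym (*-distribˡ-+ 2 c₁ c₂)) ⟩

step⇒sprouts : ∀ {T T′} → Step T T′ → ∃[ c ] c ≤ anchors T × Sprouts c T T′
step⇒sprouts anchor→dead = 0 , z≤n , ⟨ refl , refl ⟩
step⇒sprouts anchor→node = 1 , s≤s z≤n , ⟨ refl , refl ⟩
step⇒sprouts dead→dead   = 0 , z≤n , ⟨ refl , refl ⟩
step⇒sprouts (node→node sl sr) with step⇒sprouts sl | step⇒sprouts sr
... | c₁ , c₁≤ , s₁ | c₂ , c₂≤ , s₂ = c₁ + c₂ , +-mono-≤ c₁≤ c₂≤ , Sprouts-node s₁ s₂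

step⇒sprouts⁺ : ∀ {T T′} → Step T T′ → 1 ≤ anchors T′ →
                ∃[ c ] 1 ≤ c × c ≤ anchors T × Sprouts c T T′
step⇒sprouts⁺ st 1≤a′ with step⇒sprouts st
... | zero  , _   , ⟨ _ , a′ ⟩ = contradiction (subst (1 ≤_) a′ 1≤a′) λ ()
... | suc c , c≤a , s         = suc c , s≤s z≤n , c≤a , s

sprouting-step : ∀ T {c} → c ≤ anchors T → ∃[ T′ ] Step T T′ × Sprouts c T T′
sprouting-step anchor {zero}          _        = dead , anchor→dead , ⟨ refl , refl ⟩
sprouting-step anchor {suc zero}      _        = node anchor anchor , anchor→node , ⟨ refl , refl ⟩
sprouting-step anchor {suc (suc _)}   (s≤s ())
sprouting-step dead   {zero}          _        = dead , dead→dead , ⟨ refl , refl ⟩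
sprouting-step (node l r) {c} c≤
  with sprouting-step l (m⊓n≤m (anchors l) c)
     | sprouting-step r (m≤n+o⇒m∸n≤o c (anchors l) c≤)
... | l′ , sl , s₁ | r′ , sr , s₂ =
  node l′ r′ , node→node sl sr ,
  subst (λ c′ → Sprouts c′ (node l r) (node l′ r′)) (m⊓n+n∸m≡n (anchors l) c) (Sprouts-node s₁ s₂)

-- Reachable n k: some growing tree has n internal nodes and 2k anchors, where k ≥ 1.
data Reachable : ℕ → ℕ → Set where
  sprout : Reachable 1 1
  extend : ∀ {n j k} → Reachable n j → 1 ≤ k → k ≤ 2 * j → Reachable (n + k) k

Reachable⇒1≤n : ∀ {n k} → Reachable n k → 1 ≤ n
Reachable⇒1≤n sprout                    = s≤s z≤n
Reachable⇒1≤n (extend {n} {k = k} r _ _) = ≤-trans (Reachable⇒1≤n r) (m≤m+n n k)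

Reachable⇒1≤k : ∀ {n k} → Reachable n k → 1 ≤ k
Reachable⇒1≤k sprout           = s≤s z≤n
Reachable⇒1≤k (extend _ 1≤k _) = 1≤k

Reachable⇒k≤n : ∀ {n k} → Reachable n k → k ≤ n
Reachable⇒k≤n sprout                    = s≤s z≤n
Reachable⇒k≤n (extend {n} {k = k} _ _ _) = m≤n+m k n

Reachable⇒k≤n∸1 : ∀ {n k} → 1 < n → Reachable n k → k ≤ n ∸ 1
Reachable⇒k≤n∸1 1<1 sprout = contradiction 1<1 (<-irrefl refl)
Reachable⇒k≤n∸1 _ (extend {n} {k = k} r _ _) =
  subst (k ≤_) (sym (+-∸-comm k (Reachable⇒1≤n r))) (m≤n+m k (n ∸ 1))

Reachable-1 : ∀ {k} → Reachable 1 k → k ≡ 1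
Reachable-1 r = ≤-antisym (Reachable⇒k≤n r) (Reachable⇒1≤k r)

Reachable-path : ∀ n → Reachable (suc n) 1
Reachable-path zero    = sprout
Reachable-path (suc n) =
  subst (λ m → Reachable m 1) (+-comm (suc n) 1) (extend (Reachable-path n) ≤-refl (s≤s z≤n))

reach⇒Reachable : ∀ {t T} → Reach (suc t) T → 1 ≤ anchors T →
                  ∃[ k ] anchors T ≡ 2 * k × Reachable (internals T) k
reach⇒Reachable (grow start anchor→dead) ()
reach⇒Reachable (grow start anchor→node) _ = 1 , refl , sprout
reach⇒Reachable (grow r@(grow _ _) st) 1≤a′ with step⇒sprouts⁺ st 1≤a′
... | c , 1≤c , c≤a , ⟨ i′ , a′ ⟩ with reach⇒Reachable r (≤-trans 1≤c c≤a)
...   | j , a≡2j , rj =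
  c , a′ , subst (λ m → Reachable m c) (sym i′) (extend rj 1≤c (subst (c ≤_) a≡2j c≤a))

ASet⇒Reachable : ∀ {n k} → ASet n k → Reachable n k
ASet⇒Reachable (1≤k , _ , (zero , start) , _ , 1≡2k) =
  contradiction (subst (2 ≤_) (sym 1≡2k) (*-monoʳ-≤ 2 1≤k)) λ { (s≤s ()) }
ASet⇒Reachable {k = k} (1≤k , T , (suc _ , r) , refl , a≡2k)
  with reach⇒Reachable r (subst (1 ≤_) (sym a≡2k) (≤-trans 1≤k (m≤n*m k 2)))
... | j , a≡2j , rj = subst (Reachable (internals T)) (*-cancelˡ-≡ j k 2 (trans (sym a≡2j) a≡2k)) rj

Reachable⇒TPos : ∀ {n k} → Reachable n k → TPos n (2 * k)
Reachable⇒TPos sprout = node anchor anchor , (1 , grow start anchor→node) , refl , refl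
Reachable⇒TPos (extend r _ k≤2j) with Reachable⇒TPos r
... | T , (t , reach) , refl , a≡2j with sprouting-step T (subst (_ ≤_) (sym a≡2j) k≤2j)
...   | T′ , st , ⟨ i′ , a′ ⟩ = T′ , (suc t , grow reach st) , i′ , a′

ASet⇔Reachable : ∀ {n k} → ASet n k ⇔ Reachable n k
ASet⇔Reachable = mk⇔ ASet⇒Reachable λ r → Reachable⇒1≤k r , Reachable⇒TPos r

Reachable⇒≤2*max : ∀ {n k b} → Reachable n k → IsMax (Reachable (n ∸ k)) b → k ≤ 2 * b
Reachable⇒≤2*max sprout (r₀ , _) = contradiction (Reachable⇒1≤n r₀) λ ()
Reachable⇒≤2*max {k = k} (extend {n} {j} rj _ k≤2j) (_ , maximal) =
  ≤-trans k≤2j (*-monoʳ-≤ 2 (maximal j (subst (λ m → Reachable m j) (sym (m+n∸n≡m n k)) rj)))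

≤2*max⇔Reachable : ∀ {n k b} → 1 ≤ k → k ≤ n → IsMax (Reachable (n ∸ k)) b →
                   k ≤ 2 * b ⇔ Reachable n k
≤2*max⇔Reachable {k = k} 1≤k k≤n max@(rb , _) = mk⇔
  (λ k≤2b → subst (λ m → Reachable m k) (m∸n+n≡m k≤n) (extend rb 1≤k k≤2b))
  (λ r → Reachable⇒≤2*max r max)

Reachable⇔RecSet : ∀ {a n k} → (∀ m → 1 ≤ m → IsMax (Reachable m) (a m)) → 1 < n →
                   Reachable n k ⇔ RecSet a n k
Reachable⇔RecSet {a} {suc n} {k} maxima 1<n = mk⇔
  (λ r → let k≤n = Reachable⇒k≤n∸1 1<n r in
           Reachable⇒1≤k r , k≤n , Reachable⇒≤2*max r (max-at k≤n))
  (λ { (1≤k , k≤n , k≤2a) →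
        Equivalence.to (≤2*max⇔Reachable 1≤k (m≤n⇒m≤1+n k≤n) (max-at k≤n)) k≤2a })
  where
  max-at : k ≤ n → IsMax (Reachable (suc n ∸ k)) (a (suc n ∸ k))
  max-at k≤n = maxima (suc n ∸ k) (m<n⇒0<n∸m (s≤s k≤n))

Reachable-max : ∀ n → 1 ≤ n → ∃ (IsMax (Reachable n))
Reachable-max = <-rec (λ n → 1 ≤ n → ∃ (IsMax (Reachable n))) go
  where
  go : ∀ n → WfRec _<_ (λ m → 1 ≤ m → ∃ (IsMax (Reachable m))) n →
       1 ≤ n → ∃ (IsMax (Reachable n))
  go 1 _ _ = 1 , sprout , λ _ r → ≤-reflexive (Reachable-1 r)
  go n@(suc n′@(suc _)) ih _ = bounded-max reachable? n (λ _ → Reachable⇒k≤n) (Reachable-path n′)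
    where
    reachable? : Decidable (Reachable n)
    reachable? zero = no λ r → contradiction (Reachable⇒1≤k r) λ ()
    reachable? k@(suc _) with k ≤? n′
    ... | no k≰n′ = no λ r → k≰n′ (Reachable⇒k≤n∸1 (s≤s (s≤s z≤n)) r)
    ... | yes k≤n′ with ih (∸-monoʳ-< (s≤s z≤n) (m≤n⇒m≤1+n k≤n′)) (m<n⇒0<n∸m (s≤s k≤n′))
    ...   | b , max = Dec.map (≤2*max⇔Reachable (s≤s z≤n) (m≤n⇒m≤1+n k≤n′) max) (k ≤? 2 * b)

maxHalfAnchors : ℕ → ℕ
maxHalfAnchors zero      = 0
maxHalfAnchors n@(suc _) = proj₁ (Reachable-max n (s≤s z≤n))

maxHalfAnchors-isASeq : IsASeq maxHalfAnchors
maxHalfAnchors-isASeq n@(suc _) _ =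
  IsMax-resp-⇔ (λ _ → ⇔-sym ASet⇔Reachable) (proj₂ (Reachable-max n (s≤s z≤n)))

lemma3p1 : Σ (ℕ → ℕ) IsASeq
           × ((a : ℕ → ℕ) → IsASeq a →
                a 1 ≡ 1 × (∀ n → 1 < n → IsMax (RecSet a n) (a n)))
lemma3p1 = (maxHalfAnchors , maxHalfAnchors-isASeq) , λ a isASeq →
  let maxima : ∀ m → 1 ≤ m → IsMax (Reachable m) (a m)
      maxima m 1≤m = IsMax-resp-⇔ (λ _ → ASet⇔Reachable) (isASeq m 1≤m)
  in Reachable-1 (proj₁ (maxima 1 (s≤s z≤n))) ,
     λ n 1<n → IsMax-resp-⇔ (λ _ → Reachable⇔RecSet maxima 1<n) (maxima n (≤-trans (s≤s z≤n) 1<n))
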